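{- Let $k\ge 1$ and let $Q\subseteq T_k$ be a set of four points forming the vertices of a rhombus with angles $60^\circ,120^\circ,60^\circ,120^\circ$, and suppose $Q$ is minimally contained in $T_k$. Let $b_1,b_2$ be the two vertices of $Q$ at the $120^\circ$ angles of the rhombus. Then at least one of $b_1,b_2$ is the midpoint of one of the three sides of the equilateral triangle whose corners are the three corner points of $T_k$.
   Context: For a positive integer $k$, $T_k$ denotes the triangular lattice with $k$ rows: the set of points $\{a(1,0)+b(\tfrac12,\tfrac{\sqrt3}{2}) : a,b\in\mathbb{Z}_{\ge 0},\ a+b\le k-1\}$ in the plane. A copy of $T_{k-1}$ inside $T_k$ is a subset of $T_k$ of the form $t+T_{k-1}$ for a translation vector $t$ with $t+T_{k-1}\subseteq T_k$. A set $Q$ of four points of $T_k$ forming the vertices of a rhombus with angles $60^\circ$ and $120^\circ$ (i.e., the union of two equilateral triangles sharing a side) is minimally contained in $T_k$ if it is not contained in any copy of $T_{k-1}$ inside $T_k$. -}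

module Defs where

open import Data.Nat using (ℕ)
open import Data.Integer using (ℤ; +_; _+_; _-_; _*_; _≤_; _<_)
open import Data.Product using (_×_; _,_; ∃)
open import Relation.Binary.PropositionalEquality using (_≡_; _≢_)

-- A point of the triangular lattice, in lattice coordinates:
-- (a , b) stands for the plane point a(1,0) + b(1/2, √3/2).
Point : Set
Point = ℤ × ℤ

_⊕_ : Point → Point → Point
(a , b) ⊕ (c , d) = (a + c , b + d)

_⊖_ : Point → Point → Point
(a , b) ⊖ (c , d) = (a - c , b - d)

-- Squared Euclidean norm of a(1,0)+b(1/2,√3/2): a² + ab + b².
normSq : Point → ℤ
normSq (a , b) = a * a + a * b + b * b

distSq : Point → Point → ℤ
distSq x y = normSq (x ⊖ y)

InT : ℕ → Point → Set
InT n (a , b) = (+ 0 ≤ a) × (+ 0 ≤ b) × (a + b + + 1 ≤ + n)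

Equilateral : Point → Point → Point → Set
Equilateral x y z =
  (+ 0 < distSq x y) × (distSq x y ≡ distSq y z) × (distSq y z ≡ distSq z x)

-- {p, b₁, q, b₂} is a 60°-120° rhombus with the 120° angles at b₁, b₂:
-- the union of the two distinct equilateral triangles p b₁ b₂ and q b₁ b₂
-- sharing the side b₁ b₂.
Rhombus : Point → Point → Point → Point → Set
Rhombus p b₁ q b₂ = Equilateral p b₁ b₂ × Equilateral q b₁ b₂ × (p ≢ q)

InCopy : ℕ → Point → Point → Set
InCopy n t y = ∃ λ x → InT n x × (y ≡ t ⊕ x)

IsCopy : ℕ → ℕ → Point → Set
IsCopy n k t = ∀ x → InT n x → InT k (t ⊕ x)

MinimallyContained : ℕ → Point → Point → Point → Point → Set
MinimallyContained k p b₁ q b₂ =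
  ∀ (t : Point) → IsCopy (k Data.Nat.∸ 1) k t →
    (InCopy (k Data.Nat.∸ 1) t p × InCopy (k Data.Nat.∸ 1) t b₁ ×
     InCopy (k Data.Nat.∸ 1) t q × InCopy (k Data.Nat.∸ 1) t b₂) → Data.Empty.⊥
  where import Data.Empty

-- m is the midpoint of one of the three sides of the big triangle with
-- corners (0,0), (k-1,0), (0,k-1): expressed as 2m = c + c'.
twice : Point → Point
twice (a , b) = (a + a , b + b)

IsSideMidpoint : ℕ → Point → Set
IsSideMidpoint k m =
  (twice m ≡ (+ k - + 1 , + 0)) ⊎
  (twice m ≡ (+ 0 , + k - + 1)) ⊎
  (twice m ≡ (+ k - + 1 , + k - + 1))
  where open import Data.Sum using (_⊎_)

module Submission where

-- In barycentric coordinates with respect to T_k (the lattice distances to its three sides,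
-- which are nonnegative and sum to k - 1) a copy of T_(k-1) is cut out by one coordinate being
-- at least 1, so minimal containment says that each coordinate vanishes at some vertex of the
-- rhombus.
-- The vertices p, q are the two apexes b₁ + ρ d and b₁ + ρ⁻¹ d over the displacement d = b₂ - b₁,
-- because the product of the squared distances from p to these two points is a polynomial in the
-- squared sides of p b₁ b₂ that vanishes on equilateral triangles; here the 60° rotation ρ permutes
-- the barycentric coordinates of d cyclically and negates them. Up to that cyclic symmetry the
-- first two coordinates of d are both ≥ 0 or both ≤ 0, which decides the vertex minimising each
-- coordinate; the three minima being 0 then gives b₂, respectively b₁, one coordinate 0 and the
-- other two equal: it is the midpoint of a side.

open import Defs
open import Data.Nat using (ℕ; _≤_)
open import Data.Sum using (_⊎_)
open import Data.Product using (_×_)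

open import Data.Nat as ℕ using (suc; z≤n)
open import Data.Integer as ℤ using (ℤ; +_; -[1+_]; 0ℤ; 1ℤ; _+_; _-_; -_; _*_; +≤+)
open import Data.Integer.Base using (nonNegative)
open import Data.Integer.Properties
  using ( ≤-refl; ≤-trans; ≤-antisym; ≤-total; ≮⇒≥; i<j⇒suc[i]≤j
        ; +-mono-≤; +-monoʳ-≤; neg-mono-≤; i≤i+j; i≤j+i; i-j≤i; i≤j⇒0≤j-i; 0≤i-j⇒j≤i
        ; +-comm; +-identityˡ; +-identityʳ; neg-involutive; +◃n≡+n; i-j≡0⇒i≡j; i*j≡0⇒i≡0∨j≡0 )
open import Data.Integer.Tactic.RingSolver using (solve-∀; solve)
open import Data.List using (_∷_; [])
open import Data.Product using (_,_)
open import Data.Sum using (inj₁; inj₂; reduce)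
import Data.Sum as Sum
open import Data.Empty using (⊥-elim)
open import Function using (_∘_)
open import Relation.Nullary using (¬_)
open import Relation.Binary.PropositionalEquality
  using (_≡_; _≢_; refl; sym; trans; cong; cong₂; subst; module ≡-Reasoning)

≤-by-difference : ∀ {i j k l} → j - i ≡ l - k → k ℤ.≤ l → i ℤ.≤ j
≤-by-difference eq k≤l = 0≤i-j⇒j≤i (subst (0ℤ ℤ.≤_) (sym eq) (i≤j⇒0≤j-i k≤l))

i+j≤i : ∀ i {j} → j ℤ.≤ 0ℤ → i + j ℤ.≤ i
i+j≤i i j≤0 = subst (i + _ ℤ.≤_) (+-identityʳ i) (+-monoʳ-≤ i j≤0)

u+v+w≡0⇒w≡-[u+v] : ∀ u v {w} → u + v + w ≡ 0ℤ → w ≡ - (u + v)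
u+v+w≡0⇒w≡-[u+v] u v {w} Σ≡0 = begin
  w                    ≡⟨ solve (u ∷ v ∷ w ∷ []) ⟩
  u + v + w - (u + v)  ≡⟨ cong (_- (u + v)) Σ≡0 ⟩
  0ℤ - (u + v)         ≡⟨ +-identityˡ _ ⟩
  - (u + v)            ∎
  where open ≡-Reasoning

u+v+w≡0⇒v+w+u≡0 : ∀ u v w → u + v + w ≡ 0ℤ → v + w + u ≡ 0ℤ
u+v+w≡0⇒v+w+u≡0 u v w = trans (solve (u ∷ v ∷ w ∷ []))

0≤i*i : ∀ i → 0ℤ ℤ.≤ i * i
0≤i*i (+ n)    = subst (0ℤ ℤ.≤_) (sym (+◃n≡+n (n ℕ.* n))) (+≤+ z≤n)
0≤i*i -[1+ n ] = subst (0ℤ ℤ.≤_) (sym (+◃n≡+n (suc n ℕ.* suc n))) (+≤+ z≤n)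

i*i≡0⇒i≡0 : ∀ i → i * i ≡ 0ℤ → i ≡ 0ℤ
i*i≡0⇒i≡0 i = reduce ∘ i*j≡0⇒i≡0∨j≡0 i

normSq≡0⇒≡0 : ∀ a b → normSq (a , b) ≡ 0ℤ → a ≡ 0ℤ × b ≡ 0ℤ
normSq≡0⇒≡0 a b N≡0 = a≡0 , b≡0
  where
  S : ℤ
  S = (a + a + b) * (a + a + b) + b * b + b * b

  four-normSq : + 4 * (a * a + a * b + b * b) ≡ (a + a + b) * (a + a + b) + b * b + b * b + b * b
  four-normSq = solve (a ∷ b ∷ [])

  0≤S : 0ℤ ℤ.≤ S
  0≤S = +-mono-≤ (+-mono-≤ (0≤i*i (a + a + b)) (0≤i*i b)) (0≤i*i b)

  b*b≤0 : b * b ℤ.≤ 0ℤ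
  b*b≤0 = subst (b * b ℤ.≤_) (trans (sym four-normSq) (cong (+ 4 *_) N≡0))
                (i≤j+i (b * b) S {{nonNegative 0≤S}})

  b≡0 : b ≡ 0ℤ
  b≡0 = i*i≡0⇒i≡0 b (≤-antisym b*b≤0 (0≤i*i b))

  a≡0 : a ≡ 0ℤ
  a≡0 = i*i≡0⇒i≡0 a (begin
    a * a                      ≡⟨ solve (a ∷ []) ⟩
    a * a + a * 0ℤ + 0ℤ * 0ℤ   ≡⟨ cong (λ b → normSq (a , b)) (sym b≡0) ⟩
    normSq (a , b)             ≡⟨ N≡0 ⟩
    0ℤ                         ∎)
    where open ≡-Reasoning

distSq≡0⇒≡ : ∀ x y → distSq x y ≡ 0ℤ → x ≡ y
distSq≡0⇒≡ (x₁ , x₂) (y₁ , y₂) d≡0 =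
  let (e₁ , e₂) = normSq≡0⇒≡0 (x₁ - y₁) (x₂ - y₂) d≡0
  in cong₂ _,_ (i-j≡0⇒i≡j x₁ y₁ e₁) (i-j≡0⇒i≡j x₂ y₂ e₂)

-- apex a c is the image of c under the rotation by 60° about a, i.e. the third vertex of one of
-- the two equilateral triangles on the side a c; the other one is apex c a.
apex : Point → Point → Point
apex (a₁ , a₂) (c₁ , c₂) = (a₁ + a₂ - c₂ , c₁ + c₂ - a₁)

-- ((x - y)² + (y - z)² + (z - x)²) / 2
defect : ℤ → ℤ → ℤ → ℤ
defect x y z = x * x + y * y + z * z - x * y - y * z - z * x

distSq-apex-product : ∀ p a c →
  distSq p (apex a c) * distSq p (apex c a) ≡ defect (distSq p a) (distSq a c) (distSq c p)
distSq-apex-product (p₁ , p₂) (a₁ , a₂) (c₁ , c₂) = expanded p₁ p₂ a₁ a₂ c₁ c₂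
  where
  -- The ring solver does not unfold definitions such as normSq or apex, so here and below
  -- identities are proved in unfolded form and then used at the folded type.
  expanded : ∀ p₁ p₂ a₁ a₂ c₁ c₂ →
    let N : ℤ → ℤ → ℤ
        N u v = u * u + u * v + v * v
        D : ℤ → ℤ → ℤ → ℤ
        D x y z = x * x + y * y + z * z - x * y - y * z - z * x
    in N (p₁ - (a₁ + a₂ - c₂)) (p₂ - (c₁ + c₂ - a₁)) * N (p₁ - (c₁ + c₂ - a₂)) (p₂ - (a₁ + a₂ - c₁))
       ≡ D (N (p₁ - a₁) (p₂ - a₂)) (N (a₁ - c₁) (a₂ - c₂)) (N (c₁ - p₁) (c₂ - p₂))
  expanded = solve-∀

defect-diagonal : ∀ x → defect x x x ≡ 0ℤ
defect-diagonal = expanded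
  where
  expanded : ∀ x → x * x + x * x + x * x - x * x - x * x - x * x ≡ 0ℤ
  expanded = solve-∀

equilateral⇒apex : ∀ p a c → Equilateral p a c → p ≡ apex a c ⊎ p ≡ apex c a
equilateral⇒apex p a c (_ , pa≡ac , ac≡cp) =
  Sum.map (distSq≡0⇒≡ p (apex a c)) (distSq≡0⇒≡ p (apex c a)) (i*j≡0⇒i≡0∨j≡0 _ product≡0)
  where
  open ≡-Reasoning
  product≡0 : distSq p (apex a c) * distSq p (apex c a) ≡ 0ℤ
  product≡0 = begin
    distSq p (apex a c) * distSq p (apex c a)
      ≡⟨ distSq-apex-product p a c ⟩
    defect (distSq p a) (distSq a c) (distSq c p)
      ≡⟨ cong₂ (λ x z → defect x (distSq a c) z) pa≡ac (sym ac≡cp) ⟩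
    defect (distSq a c) (distSq a c) (distSq a c)
      ≡⟨ defect-diagonal (distSq a c) ⟩
    0ℤ                                                    ∎

ℤ³ : Set
ℤ³ = ℤ × ℤ × ℤ

_+³_ : ℤ³ → ℤ³ → ℤ³
(x , y , z) +³ (u , v , w) = (x + u , y + v , z + w)

sum³ : ℤ³ → ℤ
sum³ (u , v , w) = u + v + w

-- Barycentric coordinates with respect to the triangle with corners (0 , 0), (s , 0), (0 , s),
-- scaled so that they sum to s: the lattice distances to its three sides.
bary : ℤ → Point → ℤ³
bary s (a , b) = (a , b , s - (a + b))

Δ : Point → Point → ℤ³
Δ (a₁ , a₂) (c₁ , c₂) = (c₁ - a₁ , c₂ - a₂ , a₁ + a₂ - (c₁ + c₂))

-- On barycentric displacements (those with sum³ ≡ 0) the rotation by 60° acts by a cyclic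
-- shift of the coordinates followed by negation.
ρ ρ⁻¹ : ℤ³ → ℤ³
ρ (u , v , w) = (- v , - w , - u)
ρ⁻¹ (u , v , w) = (- w , - u , - v)

sum³-Δ : ∀ a c → sum³ (Δ a c) ≡ 0ℤ
sum³-Δ (a₁ , a₂) (c₁ , c₂) = expanded
  where
  expanded : c₁ - a₁ + (c₂ - a₂) + (a₁ + a₂ - (c₁ + c₂)) ≡ 0ℤ
  expanded = solve (a₁ ∷ a₂ ∷ c₁ ∷ c₂ ∷ [])

bary-Δ : ∀ s a c → bary s c ≡ bary s a +³ Δ a c
bary-Δ s (a₁ , a₂) (c₁ , c₂) = expanded
  where
  expanded : (c₁ , c₂ , s - (c₁ + c₂))
           ≡ (a₁ + (c₁ - a₁) , a₂ + (c₂ - a₂) , s - (a₁ + a₂) + (a₁ + a₂ - (c₁ + c₂)))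
  expanded = cong₂ _,_ (solve (a₁ ∷ c₁ ∷ []))
    (cong₂ _,_ (solve (a₂ ∷ c₂ ∷ [])) (solve (s ∷ a₁ ∷ a₂ ∷ c₁ ∷ c₂ ∷ [])))

bary-apex : ∀ s a c → bary s (apex a c) ≡ bary s a +³ ρ (Δ a c)
bary-apex s (a₁ , a₂) (c₁ , c₂) = expanded
  where
  expanded : (a₁ + a₂ - c₂ , c₁ + c₂ - a₁ , s - (a₁ + a₂ - c₂ + (c₁ + c₂ - a₁)))
           ≡ (a₁ - (c₂ - a₂) , a₂ - (a₁ + a₂ - (c₁ + c₂)) , s - (a₁ + a₂) - (c₁ - a₁))
  expanded = cong₂ _,_ (solve (a₁ ∷ a₂ ∷ c₂ ∷ []))
    (cong₂ _,_ (solve (a₁ ∷ a₂ ∷ c₁ ∷ c₂ ∷ [])) (solve (s ∷ a₁ ∷ a₂ ∷ c₁ ∷ c₂ ∷ [])))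

bary-apex⁻ : ∀ s a c → bary s (apex c a) ≡ bary s a +³ ρ⁻¹ (Δ a c)
bary-apex⁻ s (a₁ , a₂) (c₁ , c₂) = expanded
  where
  expanded : (c₁ + c₂ - a₂ , a₁ + a₂ - c₁ , s - (c₁ + c₂ - a₂ + (a₁ + a₂ - c₁)))
           ≡ (a₁ - (a₁ + a₂ - (c₁ + c₂)) , a₂ - (c₁ - a₁) , s - (a₁ + a₂) - (c₂ - a₂))
  expanded = cong₂ _,_ (solve (a₁ ∷ a₂ ∷ c₁ ∷ c₂ ∷ []))
    (cong₂ _,_ (solve (a₁ ∷ a₂ ∷ c₁ ∷ [])) (solve (s ∷ a₁ ∷ a₂ ∷ c₁ ∷ c₂ ∷ [])))

_≤³_ : ℤ³ → ℤ³ → Set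
(x , y , z) ≤³ (x′ , y′ , z′) = x ℤ.≤ x′ × y ℤ.≤ y′ × z ℤ.≤ z′

0³ : ℤ³
0³ = (0ℤ , 0ℤ , 0ℤ)

InT⇒0≤bary : ∀ {n} x → InT (suc n) x → 0³ ≤³ bary (+ n) x
InT⇒0≤bary {n} (x₁ , x₂) (0≤x₁ , 0≤x₂ , x∈) =
  0≤x₁ , 0≤x₂ , ≤-by-difference (difference (+ n) x₁ x₂) x∈
  where
  difference : ∀ s x₁ x₂ → s - (x₁ + x₂) - 0ℤ ≡ 1ℤ + s - (x₁ + x₂ + 1ℤ)
  difference = solve-∀

isCopy : ∀ n t → 0³ ≤³ bary 1ℤ t → IsCopy n (suc n) t
isCopy n (t₁ , t₂) (0≤t₁ , 0≤t₂ , 0≤t₃) (x₁ , x₂) (0≤x₁ , 0≤x₂ , x∈) =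
  +-mono-≤ 0≤t₁ 0≤x₁ , +-mono-≤ 0≤t₂ 0≤x₂ ,
  ≤-by-difference (difference (+ n) t₁ t₂ x₁ x₂) (+-mono-≤ 0≤t₃ x∈)
  where
  difference : ∀ s t₁ t₂ x₁ x₂ →
    1ℤ + s - (t₁ + x₁ + (t₂ + x₂) + 1ℤ) ≡ 1ℤ - (t₁ + t₂) + s - (0ℤ + (x₁ + x₂ + 1ℤ))
  difference = solve-∀

inCopy : ∀ n t x → bary 1ℤ t ≤³ bary (+ n) x → InCopy n t x
inCopy n (t₁ , t₂) (x₁ , x₂) (t₁≤x₁ , t₂≤x₂ , t₃≤x₃) =
  (x₁ - t₁ , x₂ - t₂) ,
  (i≤j⇒0≤j-i t₁≤x₁ , i≤j⇒0≤j-i t₂≤x₂ , ≤-by-difference (difference (+ n) t₁ t₂ x₁ x₂) t₃≤x₃) ,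
  cong₂ _,_ (sym (i+[j-i]≡j t₁ x₁)) (sym (i+[j-i]≡j t₂ x₂))
  where
  difference : ∀ s t₁ t₂ x₁ x₂ →
    s - (x₁ - t₁ + (x₂ - t₂) + 1ℤ) ≡ s - (x₁ + x₂) - (1ℤ - (t₁ + t₂))
  difference = solve-∀
  i+[j-i]≡j : ∀ i j → i + (j - i) ≡ j
  i+[j-i]≡j = solve-∀

LowerBound : ℤ → ℤ → ℤ → ℤ → ℤ → Set
LowerBound m a b c d = m ℤ.≤ a × m ℤ.≤ b × m ℤ.≤ c × m ℤ.≤ d

MinIsZero : ℤ → ℤ → ℤ → ℤ → Set
MinIsZero a b c d = LowerBound 0ℤ a b c d × ¬ LowerBound 1ℤ a b c d

MinimallyContained³ : ℤ³ → ℤ³ → ℤ³ → ℤ³ → Set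
MinimallyContained³ (p₁ , p₂ , p₃) (a₁ , a₂ , a₃) (q₁ , q₂ , q₃) (c₁ , c₂ , c₃) =
  MinIsZero p₁ a₁ q₁ c₁ × MinIsZero p₂ a₂ q₂ c₂ × MinIsZero p₃ a₃ q₃ c₃

minimallyContained³ : ∀ {n} p b₁ q b₂ →
  InT (suc n) p → InT (suc n) b₁ → InT (suc n) q → InT (suc n) b₂ →
  MinimallyContained (suc n) p b₁ q b₂ →
  MinimallyContained³ (bary (+ n) p) (bary (+ n) b₁) (bary (+ n) q) (bary (+ n) b₂)
minimallyContained³ {n} p b₁ q b₂ inP inB₁ inQ inB₂ mc
  with InT⇒0≤bary p inP | InT⇒0≤bary b₁ inB₁ | InT⇒0≤bary q inQ | InT⇒0≤bary b₂ inB₂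
... | (0≤p₁ , 0≤p₂ , 0≤p₃) | (0≤a₁ , 0≤a₂ , 0≤a₃) | (0≤q₁ , 0≤q₂ , 0≤q₃) | (0≤c₁ , 0≤c₂ , 0≤c₃) =
    ( (0≤p₁ , 0≤a₁ , 0≤q₁ , 0≤c₁)
    , λ (1≤p₁ , 1≤a₁ , 1≤q₁ , 1≤c₁) → outside (1ℤ , 0ℤ) 0≤corner
        ( (1≤p₁ , 0≤p₂ , 0≤p₃) , (1≤a₁ , 0≤a₂ , 0≤a₃)
        , (1≤q₁ , 0≤q₂ , 0≤q₃) , (1≤c₁ , 0≤c₂ , 0≤c₃) ) )
  , ( (0≤p₂ , 0≤a₂ , 0≤q₂ , 0≤c₂)
    , λ (1≤p₂ , 1≤a₂ , 1≤q₂ , 1≤c₂) → outside (0ℤ , 1ℤ) 0≤corner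
        ( (0≤p₁ , 1≤p₂ , 0≤p₃) , (0≤a₁ , 1≤a₂ , 0≤a₃)
        , (0≤q₁ , 1≤q₂ , 0≤q₃) , (0≤c₁ , 1≤c₂ , 0≤c₃) ) )
  , ( (0≤p₃ , 0≤a₃ , 0≤q₃ , 0≤c₃)
    , λ (1≤p₃ , 1≤a₃ , 1≤q₃ , 1≤c₃) → outside (0ℤ , 0ℤ) 0≤corner
        ( (0≤p₁ , 0≤p₂ , 1≤p₃) , (0≤a₁ , 0≤a₂ , 1≤a₃)
        , (0≤q₁ , 0≤q₂ , 1≤q₃) , (0≤c₁ , 0≤c₂ , 1≤c₃) ) )
  where
  0≤corner : ∀ {i j k} → 0³ ≤³ (+ i , + j , + k)
  0≤corner = +≤+ z≤n , +≤+ z≤n , +≤+ z≤n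

  outside : ∀ t → 0³ ≤³ bary 1ℤ t →
    ¬ (bary 1ℤ t ≤³ bary (+ n) p × bary 1ℤ t ≤³ bary (+ n) b₁ ×
       bary 1ℤ t ≤³ bary (+ n) q × bary 1ℤ t ≤³ bary (+ n) b₂)
  outside t 0≤t (hp , hb₁ , hq , hb₂) =
    mc t (isCopy n t 0≤t)
      (inCopy n t p hp , inCopy n t b₁ hb₁ , inCopy n t q hq , inCopy n t b₂ hb₂)

least≡0 : ∀ {m a b c d} → MinIsZero a b c d → 0ℤ ℤ.≤ m → LowerBound m a b c d → m ≡ 0ℤ
least≡0 {m} (_ , ¬1≤all) 0≤m (m≤a , m≤b , m≤c , m≤d) = ≤-antisym (≮⇒≥ 0≮m) 0≤m
  where
  0≮m : ¬ 0ℤ ℤ.< m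
  0≮m 0<m = let 1≤m = i<j⇒suc[i]≤j 0<m in
    ¬1≤all (≤-trans 1≤m m≤a , ≤-trans 1≤m m≤b , ≤-trans 1≤m m≤c , ≤-trans 1≤m m≤d)

SideMidpoint³ : ℤ³ → Set
SideMidpoint³ (x , y , z) = (y ≡ 0ℤ × z ≡ x) ⊎ (x ≡ 0ℤ × y ≡ z) ⊎ (z ≡ 0ℤ × x ≡ y)

sideMidpoint³-rotate : ∀ {x y z} → SideMidpoint³ (y , z , x) → SideMidpoint³ (x , y , z)
sideMidpoint³-rotate (inj₁ h)        = inj₂ (inj₂ h)
sideMidpoint³-rotate (inj₂ (inj₁ h)) = inj₁ h
sideMidpoint³-rotate (inj₂ (inj₂ h)) = inj₂ (inj₁ h)

positive-sector : ∀ {x y z u v w} → 0ℤ ℤ.≤ u → 0ℤ ℤ.≤ v → u + v + w ≡ 0ℤ →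
  MinIsZero (x - v) x (x - w) (x + u) →
  MinIsZero (y - w) y (y - u) (y + v) →
  MinIsZero (z - u) z (z - v) (z + w) →
  SideMidpoint³ (x + u , y + v , z + w)
positive-sector {x} {y} {z} {u} {v} {w} 0≤u 0≤v Σ≡0
  mx@((0≤x-v , _) , _) my@((_ , _ , 0≤y-u , _) , _) mz@((_ , _ , _ , 0≤z+w) , _) =
  inj₂ (inj₂ (z+w≡0 , x+u≡y+v))
  where
  w≡-[u+v] : w ≡ - (u + v)
  w≡-[u+v] = u+v+w≡0⇒w≡-[u+v] u v Σ≡0

  w≤-u : w ℤ.≤ - u
  w≤-u = subst (ℤ._≤ - u) (sym w≡-[u+v]) (neg-mono-≤ (i≤i+j u v {{nonNegative 0≤v}}))
  w≤-v : w ℤ.≤ - v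
  w≤-v = subst (ℤ._≤ - v) (sym w≡-[u+v]) (neg-mono-≤ (i≤j+i v u {{nonNegative 0≤u}}))
  w≤0 : w ℤ.≤ 0ℤ
  w≤0 = subst (ℤ._≤ 0ℤ) (sym w≡-[u+v]) (neg-mono-≤ (+-mono-≤ 0≤u 0≤v))

  x-v≡0 : x - v ≡ 0ℤ
  x-v≡0 = least≡0 mx 0≤x-v
    ( ≤-refl
    , i-j≤i x v {{nonNegative 0≤v}}
    , +-monoʳ-≤ x (neg-mono-≤ (≤-trans w≤0 0≤v))
    , +-monoʳ-≤ x (≤-trans (neg-mono-≤ 0≤v) 0≤u) )
  y-u≡0 : y - u ≡ 0ℤ
  y-u≡0 = least≡0 my 0≤y-u
    ( +-monoʳ-≤ y (neg-mono-≤ (≤-trans w≤0 0≤u))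
    , i-j≤i y u {{nonNegative 0≤u}}
    , ≤-refl
    , +-monoʳ-≤ y (≤-trans (neg-mono-≤ 0≤u) 0≤v) )
  z+w≡0 : z + w ≡ 0ℤ
  z+w≡0 = least≡0 mz 0≤z+w (+-monoʳ-≤ z w≤-u , i+j≤i z w≤0 , +-monoʳ-≤ z w≤-v , ≤-refl)

  x+u≡y+v : x + u ≡ y + v
  x+u≡y+v = begin
    x + u  ≡⟨ cong (_+ u) (i-j≡0⇒i≡j x v x-v≡0) ⟩
    v + u  ≡⟨ +-comm v u ⟩
    u + v  ≡⟨ cong (_+ v) (sym (i-j≡0⇒i≡j y u y-u≡0)) ⟩
    y + v  ∎
    where open ≡-Reasoning

negative-sector : ∀ {x y z u v w} → u ℤ.≤ 0ℤ → v ℤ.≤ 0ℤ → u + v + w ≡ 0ℤ →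
  MinIsZero (x - v) x (x - w) (x + u) →
  MinIsZero (y - w) y (y - u) (y + v) →
  MinIsZero (z - u) z (z - v) (z + w) →
  SideMidpoint³ (x , y , z)
negative-sector {x} {y} {z} {u} {v} {w} u≤0 v≤0 Σ≡0
  mx@((_ , _ , 0≤x-w , _) , _) my@((0≤y-w , _) , _) mz@((_ , 0≤z , _) , _) =
  inj₂ (inj₂ (z≡0 , trans (i-j≡0⇒i≡j x w x-w≡0) (sym (i-j≡0⇒i≡j y w y-w≡0))))
  where
  w≡-[u+v] : w ≡ - (u + v)
  w≡-[u+v] = u+v+w≡0⇒w≡-[u+v] u v Σ≡0

  -w≡u+v : - w ≡ u + v
  -w≡u+v = trans (cong -_ w≡-[u+v]) (neg-involutive (u + v))

  0≤w : 0ℤ ℤ.≤ w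
  0≤w = subst (0ℤ ℤ.≤_) (sym w≡-[u+v]) (neg-mono-≤ (+-mono-≤ u≤0 v≤0))
  -w≤u : - w ℤ.≤ u
  -w≤u = subst (ℤ._≤ u) (sym -w≡u+v) (i+j≤i u v≤0)
  -w≤v : - w ℤ.≤ v
  -w≤v = subst (ℤ._≤ v) (sym (trans -w≡u+v (+-comm u v))) (i+j≤i v u≤0)

  x-w≡0 : x - w ≡ 0ℤ
  x-w≡0 = least≡0 mx 0≤x-w
    ( +-monoʳ-≤ x (neg-mono-≤ (≤-trans v≤0 0≤w))
    , i-j≤i x w {{nonNegative 0≤w}}
    , ≤-refl
    , +-monoʳ-≤ x -w≤u )
  y-w≡0 : y - w ≡ 0ℤ
  y-w≡0 = least≡0 my 0≤y-w
    ( ≤-refl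
    , i-j≤i y w {{nonNegative 0≤w}}
    , +-monoʳ-≤ y (neg-mono-≤ (≤-trans u≤0 0≤w))
    , +-monoʳ-≤ y -w≤v )
  z≡0 : z ≡ 0ℤ
  z≡0 = least≡0 mz 0≤z
    ( i≤i+j z (- u) {{nonNegative (neg-mono-≤ u≤0)}}
    , ≤-refl
    , i≤i+j z (- v) {{nonNegative (neg-mono-≤ v≤0)}}
    , i≤i+j z w {{nonNegative 0≤w}} )

rhombus-sideMidpoint³ : ∀ {P A Q C} d → sum³ d ≡ 0ℤ →
  P ≡ A +³ ρ d → Q ≡ A +³ ρ⁻¹ d → C ≡ A +³ d →
  MinimallyContained³ P A Q C → SideMidpoint³ A ⊎ SideMidpoint³ C
rhombus-sideMidpoint³ {A = x , y , z} (u , v , w) Σ≡0 refl refl refl (mx , my , mz) =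
  by-signs (≤-total 0ℤ u) (≤-total 0ℤ v) (≤-total 0ℤ w)
  where
  Σ′≡0 : v + w + u ≡ 0ℤ
  Σ′≡0 = u+v+w≡0⇒v+w+u≡0 u v w Σ≡0
  Σ″≡0 : w + u + v ≡ 0ℤ
  Σ″≡0 = u+v+w≡0⇒v+w+u≡0 v w u Σ′≡0

  by-signs : 0ℤ ℤ.≤ u ⊎ u ℤ.≤ 0ℤ → 0ℤ ℤ.≤ v ⊎ v ℤ.≤ 0ℤ → 0ℤ ℤ.≤ w ⊎ w ℤ.≤ 0ℤ →
    SideMidpoint³ (x , y , z) ⊎ SideMidpoint³ (x + u , y + v , z + w)
  by-signs (inj₁ 0≤u) (inj₁ 0≤v) _          = inj₂ (positive-sector 0≤u 0≤v Σ≡0 mx my mz)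
  by-signs (inj₂ u≤0) (inj₂ v≤0) _          = inj₁ (negative-sector u≤0 v≤0 Σ≡0 mx my mz)
  by-signs _          (inj₁ 0≤v) (inj₁ 0≤w) =
    inj₂ (sideMidpoint³-rotate (positive-sector 0≤v 0≤w Σ′≡0 my mz mx))
  by-signs _          (inj₂ v≤0) (inj₂ w≤0) =
    inj₁ (sideMidpoint³-rotate (negative-sector v≤0 w≤0 Σ′≡0 my mz mx))
  by-signs (inj₁ 0≤u) _          (inj₁ 0≤w) =
    inj₂ (sideMidpoint³-rotate (sideMidpoint³-rotate (positive-sector 0≤w 0≤u Σ″≡0 mz mx my)))
  by-signs (inj₂ u≤0) _          (inj₂ w≤0) =
    inj₁ (sideMidpoint³-rotate (sideMidpoint³-rotate (negative-sector w≤0 u≤0 Σ″≡0 mz mx my)))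

sum³-bary : ∀ s m → sum³ (bary s m) ≡ s
sum³-bary s (a , b) = expanded
  where
  expanded : a + b + (s - (a + b)) ≡ s
  expanded = solve (s ∷ a ∷ b ∷ [])

SideMidpoint³⇒twice : ∀ {x y z s} → x + y + z ≡ s → SideMidpoint³ (x , y , z) →
  (x + x , y + y) ≡ (s , 0ℤ) ⊎ (x + x , y + y) ≡ (0ℤ , s) ⊎ (x + x , y + y) ≡ (s , s)
SideMidpoint³⇒twice {x} Σ≡s (inj₁ (refl , refl)) =
  inj₁ (cong₂ _,_ (trans (cong (_+ x) (sym (+-identityʳ x))) Σ≡s) refl)
SideMidpoint³⇒twice {y = y} Σ≡s (inj₂ (inj₁ (refl , refl))) =
  inj₂ (inj₁ (cong₂ _,_ refl (trans (cong (_+ y) (sym (+-identityˡ y))) Σ≡s)))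
SideMidpoint³⇒twice {x} {s = s} Σ≡s (inj₂ (inj₂ (refl , refl))) =
  inj₂ (inj₂ (cong₂ _,_ x+x≡s x+x≡s))
  where
  x+x≡s : x + x ≡ s
  x+x≡s = trans (sym (+-identityʳ (x + x))) Σ≡s

SideMidpoint³⇒IsSideMidpoint : ∀ n m → SideMidpoint³ (bary (+ n) m) → IsSideMidpoint (suc n) m
SideMidpoint³⇒IsSideMidpoint n m =
  SideMidpoint³⇒twice (trans (sum³-bary (+ n) m) (sym (suc-1 (+ n))))
  where
  suc-1 : ∀ s → 1ℤ + s - 1ℤ ≡ s
  suc-1 = solve-∀

MinimallyContained-swap : ∀ {k p b₁ q b₂} →
  MinimallyContained k p b₁ q b₂ → MinimallyContained k q b₁ p b₂
MinimallyContained-swap mc t t-copy (q∈ , b₁∈ , p∈ , b₂∈) = mc t t-copy (p∈ , b₁∈ , q∈ , b₂∈)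

apex-rhombus-sideMidpoint : ∀ n {p q} a c → p ≡ apex a c → q ≡ apex c a →
  InT (suc n) p → InT (suc n) a → InT (suc n) q → InT (suc n) c →
  MinimallyContained (suc n) p a q c →
  IsSideMidpoint (suc n) a ⊎ IsSideMidpoint (suc n) c
apex-rhombus-sideMidpoint n {p} {q} a c p≡ q≡ inP inA inQ inC mc =
  Sum.map (SideMidpoint³⇒IsSideMidpoint n a) (SideMidpoint³⇒IsSideMidpoint n c)
    (rhombus-sideMidpoint³ (Δ a c) (sum³-Δ a c)
      (trans (cong (bary (+ n)) p≡) (bary-apex (+ n) a c))
      (trans (cong (bary (+ n)) q≡) (bary-apex⁻ (+ n) a c))
      (bary-Δ (+ n) a c)
      (minimallyContained³ p a q c inP inA inQ inC mc))

rhombus-apexes : ∀ {p q} a c →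
  (p ≡ apex a c ⊎ p ≡ apex c a) → (q ≡ apex a c ⊎ q ≡ apex c a) → p ≢ q →
  (p ≡ apex a c × q ≡ apex c a) ⊎ (q ≡ apex a c × p ≡ apex c a)
rhombus-apexes _ _ (inj₁ p≡) (inj₁ q≡) p≢q = ⊥-elim (p≢q (trans p≡ (sym q≡)))
rhombus-apexes _ _ (inj₂ p≡) (inj₂ q≡) p≢q = ⊥-elim (p≢q (trans p≡ (sym q≡)))
rhombus-apexes _ _ (inj₁ p≡) (inj₂ q≡) _ = inj₁ (p≡ , q≡)
rhombus-apexes _ _ (inj₂ p≡) (inj₁ q≡) _ = inj₂ (q≡ , p≡)

mainTheorem5 : (k : ℕ) → 1 ≤ k → (p b₁ q b₂ : Point) →
    InT k p → InT k b₁ → InT k q → InT k b₂ →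
    Rhombus p b₁ q b₂ → MinimallyContained k p b₁ q b₂ →
    IsSideMidpoint k b₁ ⊎ IsSideMidpoint k b₂
mainTheorem5 (suc n) _ p b₁ q b₂ inP inB₁ inQ inB₂ (p-apex , q-apex , p≢q) mc =
  oriented (rhombus-apexes b₁ b₂
    (equilateral⇒apex p b₁ b₂ p-apex) (equilateral⇒apex q b₁ b₂ q-apex) p≢q)
  where
  oriented : (p ≡ apex b₁ b₂ × q ≡ apex b₂ b₁) ⊎ (q ≡ apex b₁ b₂ × p ≡ apex b₂ b₁) →
    IsSideMidpoint (suc n) b₁ ⊎ IsSideMidpoint (suc n) b₂
  oriented (inj₁ (p≡ , q≡)) = apex-rhombus-sideMidpoint n b₁ b₂ p≡ q≡ inP inB₁ inQ inB₂ mc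
  oriented (inj₂ (q≡ , p≡)) =
    apex-rhombus-sideMidpoint n b₁ b₂ q≡ p≡ inQ inB₁ inP inB₂ (MinimallyContained-swap mc)
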